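{- The graph $G_{\mathcal T} := G[\bigcup_{T \in \mathcal T} T]$ is either connected or consists of two connected components.
   Context: Let $(G;T_1,\dots,T_k)$ be a pairwise $\frac{1}{2}$-dense instance of Steiner Forest without Steiner nodes, i.e. $V(G)=T_1\cup\dots\cup T_k$ with the $T_i$ pairwise disjoint, and each terminal $t\in T_i$ has at least $|T_j|/2$ neighbours in $T_j$ for every $j\neq i$. Let $\mathcal T$ be a family of at least two of the terminal sets. -}

module Defs where

open import Data.Nat using (ℕ; _*_; _≤_)
open import Data.Fin using (Fin; _≟_)
open import Data.Fin.Properties using ()
open import Data.Bool using (Bool; true; false; _∧_)
open import Data.List using (List; filter)
open import Data.List as L using (length)
open import Data.List.Base using ()
open import Data.Fin.Base using ()
open import Data.Product using (Σ; _×_; ∃)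
open import Relation.Binary.PropositionalEquality using (_≡_; _≢_)
open import Relation.Nullary.Decidable using (⌊_⌋)
open import Data.List using (allFin)

record Graph (n : ℕ) : Set where
  field
    adj     : Fin n → Fin n → Bool
    symm    : ∀ u v → adj u v ≡ adj v u
    irrefl  : ∀ v → adj v v ≡ false
open Graph public

countV : ∀ {n} → (Fin n → Bool) → ℕ
countV {n} p = length (filter (λ v → p v Data.Bool.≟ true) (allFin n))

-- |T_j| where the partition V(G) = T_1 ∪ … ∪ T_k is given by  part : Fin n → Fin k
-- (part v = i  iff  v ∈ T_i; this makes the T_i pairwise disjoint and covering V(G)).
size : ∀ {n k} → (Fin n → Fin k) → Fin k → ℕ
size part j = countV (λ v → ⌊ part v ≟ j ⌋)

nbrsIn : ∀ {n k} → Graph n → (Fin n → Fin k) → Fin n → Fin k → ℕ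
nbrsIn G part t j = countV (λ v → adj G t v ∧ ⌊ part v ≟ j ⌋)

PairwiseHalfDense : ∀ {n k} → Graph n → (Fin n → Fin k) → Set
PairwiseHalfDense G part =
  ∀ t j → part t ≢ j → size part j ≤ 2 * nbrsIn G part t j

InUnion : ∀ {n k} → (Fin n → Fin k) → (Fin k → Set) → Fin n → Set
InUnion part 𝒯 v = 𝒯 (part v)

data Reach {n} (G : Graph n) (S : Fin n → Set) (u : Fin n) : Fin n → Set where
  here : S u → Reach G S u u
  step : ∀ {v w} → Reach G S u v → adj G v w ≡ true → S w → Reach G S u w

-- G[S] has at most two connected components: there are two vertices r₁ r₂ of S
-- (possibly equal) such that every vertex of S is connected in G[S] to r₁ or r₂.
AtMostTwoComponents : ∀ {n} → Graph n → (Fin n → Set) → Set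
AtMostTwoComponents G S =
  Σ _ λ r₁ → Σ _ λ r₂ → S r₁ × S r₂ ×
    (∀ v → S v → Data.Sum._⊎_ (Reach G S r₁ v) (Reach G S r₂ v))
  where import Data.Sum

-- The whole argument rests on one counting fact, the covering lemma: if x and y
-- lie outside T_m and z ∈ T_m, then x and y have a common neighbour in T_m, or z is
-- adjacent to x or to y.  Indeed N(x) ∩ T_m and N(y) ∩ T_m each contain at least
-- half of T_m; if they were disjoint and both missed z they would be disjoint
-- subsets of T_m ∖ {z}, which is too small.
--
-- Fix distinct T_i, T_j ∈ 𝒯 and a ∈ T_i.  If a is adjacent to all of T_j, then
-- every vertex of T_j is a neighbour of a, and every other vertex has a neighbour
-- in T_j (density, T_j ≠ ∅), so G[⋃ 𝒯] is connected.  Otherwise pick b ∈ T_j not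
-- adjacent to a; two applications of the covering lemma show that every vertex is
-- joined to a or to b by a walk of length at most two.
module Submission where

open import Defs
open import Data.Nat using (ℕ; suc; _+_; _*_; _≤_; _<_; s≤s; z≤n)
open import Data.Nat.Properties
  using (≤-refl; ≤-trans; <-irrefl; +-mono-≤; +-mono-≤-<; *-cancelˡ-≤; *-distribˡ-+;
         +-identityʳ; +-commutativeSemigroup; module ≤-Reasoning)
open import Algebra.Properties.CommutativeSemigroup +-commutativeSemigroup using (interchange)
open import Data.Fin using (Fin; _≟_)
open import Data.Fin.Properties using (any?)
open import Data.Bool using (Bool; true; false; _∧_)
import Data.Bool as Bool
open import Data.List using (List; []; _∷_; filter; length; allFin)
import Data.List.Relation.Unary.Any as Any
open import Data.List.Membership.Propositional using (_∈_)
open import Data.List.Membership.Propositional.Properties using (∈-allFin)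
open import Data.Product using (_×_; ∃; _,_; proj₁; proj₂)
open import Data.Sum using (_⊎_; inj₁; inj₂)
open import Data.Empty using (⊥; ⊥-elim)
open import Relation.Nullary using (Dec; yes; no; ¬_)
open import Relation.Nullary.Decidable using (⌊_⌋; _×-dec_; ¬?; decidable-stable)
open import Relation.Binary.PropositionalEquality using (_≡_; _≢_; refl; sym; trans; subst; cong)

count : ∀ {n} → (Fin n → Bool) → List (Fin n) → ℕ
count p xs = length (filter (λ v → p v Bool.≟ true) xs)

ind : Bool → ℕ
ind true  = 1
ind false = 0

count-∷ : ∀ {n} (p : Fin n → Bool) x xs → count p (x ∷ xs) ≡ ind (p x) + count p xs
count-∷ p x xs with p x
... | true  = refl
... | false = refl

count-witness : ∀ {n} (p : Fin n → Bool) xs → 1 ≤ count p xs → ∃ λ v → p v ≡ true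
count-witness p (x ∷ xs) pos with p x in px
... | true  = x , px
... | false = count-witness p xs pos

_⊆_ : ∀ {n} → (Fin n → Bool) → (Fin n → Bool) → Set
p ⊆ s = ∀ v → p v ≡ true → s v ≡ true

Disjoint : ∀ {n} → (Fin n → Bool) → (Fin n → Bool) → Set
Disjoint p q = ∀ v → p v ≡ true → q v ≡ true → ⊥

-- Pointwise form of |P| + |Q| ≤ |S| for disjoint P, Q ⊆ S.
ind-disjoint : ∀ a b c → (a ≡ true → b ≡ true → ⊥) → (a ≡ true → c ≡ true) → (b ≡ true → c ≡ true)
             → ind a + ind b ≤ ind c
ind-disjoint true  true  _     apart _   _   = ⊥-elim (apart refl refl)
ind-disjoint true  false _     _     a⊆c _   rewrite a⊆c refl = ≤-refl
ind-disjoint false true  _     _     _   b⊆c rewrite b⊆c refl = ≤-refl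
ind-disjoint false false _     _     _   _   = z≤n

count-∷₂ : ∀ {n} (p q : Fin n → Bool) x xs
         → count p (x ∷ xs) + count q (x ∷ xs) ≡ (ind (p x) + ind (q x)) + (count p xs + count q xs)
count-∷₂ p q x xs rewrite count-∷ p x xs | count-∷ q x xs =
  interchange (ind (p x)) (count p xs) (ind (q x)) (count q xs)

count-disjoint : ∀ {n} {p q s : Fin n → Bool} → Disjoint p q → p ⊆ s → q ⊆ s
               → ∀ xs → count p xs + count q xs ≤ count s xs
count-disjoint apart p⊆s q⊆s [] = z≤n
count-disjoint {p = p} {q} {s} apart p⊆s q⊆s (x ∷ xs) = begin
  count p (x ∷ xs) + count q (x ∷ xs)            ≡⟨ count-∷₂ p q x xs ⟩
  (ind (p x) + ind (q x)) + (count p xs + count q xs)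
    ≤⟨ +-mono-≤ (ind-disjoint (p x) (q x) (s x) (apart x) (p⊆s x) (q⊆s x))
                (count-disjoint apart p⊆s q⊆s xs) ⟩
  ind (s x) + count s xs                         ≡⟨ sym (count-∷ s x xs) ⟩
  count s (x ∷ xs)                               ∎
  where open ≤-Reasoning

count-disjoint-missing : ∀ {n} {p q s : Fin n → Bool} {z} → Disjoint p q → p ⊆ s → q ⊆ s
                       → s z ≡ true → p z ≡ false → q z ≡ false
                       → ∀ {xs} → z ∈ xs → count p xs + count q xs < count s xs
count-disjoint-missing {p = p} {q} {s} {z} apart p⊆s q⊆s sz pz qz {z ∷ xs} (Any.here refl) = begin-strict
  count p (z ∷ xs) + count q (z ∷ xs)            ≡⟨ count-∷₂ p q z xs ⟩
  (ind (p z) + ind (q z)) + (count p xs + count q xs)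
                                                 ≡⟨ z-missing ⟩
  count p xs + count q xs                        <⟨ s≤s (count-disjoint apart p⊆s q⊆s xs) ⟩
  1 + count s xs                                 ≡⟨ cong (λ b → ind b + count s xs) (sym sz) ⟩
  ind (s z) + count s xs                         ≡⟨ sym (count-∷ s z xs) ⟩
  count s (z ∷ xs)                               ∎
  where
  open ≤-Reasoning
  z-missing : (ind (p z) + ind (q z)) + (count p xs + count q xs) ≡ count p xs + count q xs
  z-missing rewrite pz | qz = refl
count-disjoint-missing {p = p} {q} {s} apart p⊆s q⊆s sz pz qz {x ∷ xs} (Any.there z∈xs) = begin-strict
  count p (x ∷ xs) + count q (x ∷ xs)            ≡⟨ count-∷₂ p q x xs ⟩
  (ind (p x) + ind (q x)) + (count p xs + count q xs)
    <⟨ +-mono-≤-< (ind-disjoint (p x) (q x) (s x) (apart x) (p⊆s x) (q⊆s x))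
                  (count-disjoint-missing apart p⊆s q⊆s sz pz qz z∈xs) ⟩
  ind (s x) + count s xs                         ≡⟨ sym (count-∷ s x xs) ⟩
  count s (x ∷ xs)                               ∎
  where open ≤-Reasoning

halves-sum : ∀ s a b → s ≤ 2 * a → s ≤ 2 * b → s ≤ a + b
halves-sum s a b s≤2a s≤2b = *-cancelˡ-≤ 2 (begin
  2 * s          ≡⟨ cong (s +_) (+-identityʳ s) ⟩
  s + s          ≤⟨ +-mono-≤ s≤2a s≤2b ⟩
  2 * a + 2 * b  ≡⟨ sym (*-distribˡ-+ 2 a b) ⟩
  2 * (a + b)    ∎)
  where open ≤-Reasoning

adj-sym : ∀ {n} (G : Graph n) {u v} → adj G u v ≡ true → adj G v u ≡ true
adj-sym G {u} {v} uv = trans (symm G v u) uv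

twoStep : ∀ {n} {G : Graph n} {S : Fin n → Set} {u w v}
        → S u → adj G u w ≡ true → S w → adj G w v ≡ true → S v → Reach G S u v
twoStep Su uw Sw wv Sv = step (step (here Su) uw Sw) wv Sv

module HalfDense {n k} (G : Graph n) (part : Fin n → Fin k)
                 (nonempty : ∀ i → 1 ≤ size part i)
                 (dense : PairwiseHalfDense G part) where

  inPart : Fin k → Fin n → Bool
  inPart m v = ⌊ part v ≟ m ⌋

  nbrsInPart : Fin n → Fin k → Fin n → Bool
  nbrsInPart t m v = adj G t v ∧ inPart m v

  inPart-sound : ∀ {m v} → inPart m v ≡ true → part v ≡ m
  inPart-sound {m} {v} h with part v ≟ m
  ... | yes pv≡m = pv≡m

  inPart-complete : ∀ {m v} → part v ≡ m → inPart m v ≡ true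
  inPart-complete {m} {v} pv≡m with part v ≟ m
  ... | yes _    = refl
  ... | no pv≢m  = ⊥-elim (pv≢m pv≡m)

  nbrsInPart-sound : ∀ {t m v} → nbrsInPart t m v ≡ true → adj G t v ≡ true × part v ≡ m
  nbrsInPart-sound {t} {m} {v} h with adj G t v
  ... | true = refl , inPart-sound h

  CommonNeighbourIn : Fin k → Fin n → Fin n → Set
  CommonNeighbourIn m x y = ∃ λ w → part w ≡ m × adj G x w ≡ true × adj G y w ≡ true

  commonNeighbourIn? : ∀ m x y → Dec (CommonNeighbourIn m x y)
  commonNeighbourIn? m x y =
    any? λ w → (part w ≟ m) ×-dec ((adj G x w Bool.≟ true) ×-dec (adj G y w Bool.≟ true))

  vertexIn : ∀ m → ∃ λ v → part v ≡ m
  vertexIn m with count-witness (inPart m) (allFin n) (nonempty m)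
  ... | v , v∈Tm = v , inPart-sound v∈Tm

  neighbourIn : ∀ {t m} → part t ≢ m → ∃ λ w → part w ≡ m × adj G t w ≡ true
  neighbourIn {t} {m} pt≢m
    with count-witness (nbrsInPart t m) (allFin n) (positive (≤-trans (nonempty m) (dense t m pt≢m)))
    where
    positive : ∀ {c} → 1 ≤ 2 * c → 1 ≤ c
    positive {suc _} _ = s≤s z≤n
  ... | w , tw with nbrsInPart-sound tw
  ... | t∼w , pw≡m = w , pw≡m , t∼w

  noRoomInPart : ∀ {x y z m} → part x ≢ m → part y ≢ m → part z ≡ m
               → adj G x z ≡ false → adj G y z ≡ false → ¬ CommonNeighbourIn m x y → ⊥
  noRoomInPart {x} {y} {z} {m} px≢m py≢m pz≡m xz yz noCommon = <-irrefl refl (begin-strict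
    size part m                                                   ≤⟨ halves ⟩
    count (nbrsInPart x m) (allFin n) + count (nbrsInPart y m) (allFin n)
                                                                  <⟨ tooSmall ⟩
    size part m                                                   ∎)
    where
    open ≤-Reasoning
    halves : size part m ≤ count (nbrsInPart x m) (allFin n) + count (nbrsInPart y m) (allFin n)
    halves = halves-sum (size part m) (nbrsIn G part x m) (nbrsIn G part y m)
                        (dense x m px≢m) (dense y m py≢m)

    apart : Disjoint (nbrsInPart x m) (nbrsInPart y m)
    apart w xw yw with nbrsInPart-sound xw | nbrsInPart-sound yw
    ... | x∼w , pw≡m | y∼w , _ = noCommon (w , pw≡m , x∼w , y∼w)

    inside : ∀ t → nbrsInPart t m ⊆ inPart m
    inside t w tw = inPart-complete (proj₂ (nbrsInPart-sound tw))

    tooSmall : count (nbrsInPart x m) (allFin n) + count (nbrsInPart y m) (allFin n) < size part m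
    tooSmall = count-disjoint-missing apart (inside x) (inside y) (inPart-complete pz≡m)
                 (cong (_∧ inPart m z) xz) (cong (_∧ inPart m z) yz) (∈-allFin z)

  cover : ∀ {x y z m} → part x ≢ m → part y ≢ m → part z ≡ m
        → CommonNeighbourIn m x y ⊎ adj G x z ≡ true ⊎ adj G y z ≡ true
  cover {x} {y} {z} {m} px≢m py≢m pz≡m with adj G x z in xz | adj G y z in yz
  ... | true  | _     = inj₂ (inj₁ refl)
  ... | false | true  = inj₂ (inj₂ refl)
  ... | false | false with commonNeighbourIn? m x y
  ...   | yes common  = inj₁ common
  ...   | no noCommon = ⊥-elim (noRoomInPart px≢m py≢m pz≡m xz yz noCommon)

  module _ (𝒯 : Fin k → Set) where

    S : Fin n → Set
    S = InUnion part 𝒯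

    inS : ∀ {v m} → part v ≡ m → 𝒯 m → S v
    inS pv≡m 𝒯m = subst 𝒯 (sym pv≡m) 𝒯m

    dominatingVertex : ∀ {a j} → S a → 𝒯 j → (∀ v → part v ≡ j → adj G a v ≡ true)
                     → ∀ v → S v → Reach G S a v
    dominatingVertex {a} {j} Sa 𝒯j a∼Tj v Sv with part v ≟ j
    ... | yes pv≡j = step (here Sa) (a∼Tj v pv≡j) Sv
    ... | no pv≢j with neighbourIn pv≢j
    ...   | w , pw≡j , v∼w = twoStep Sa (a∼Tj w pw≡j) (inS pw≡j 𝒯j) (adj-sym G v∼w) Sv

    nonAdjacentPair : ∀ {a b} → S a → S b → part a ≢ part b → adj G a b ≢ true
                    → ∀ v → S v → Reach G S a v ⊎ Reach G S b v
    nonAdjacentPair {a} {b} Sa Sb pa≢pb a≁b v Sv with part v ≟ part b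
    ... | yes pv≡pb with cover {v} {b} {a} (λ pv≡pa → pa≢pb (trans (sym pv≡pa) pv≡pb))
                                         (λ pb≡pa → pa≢pb (sym pb≡pa)) refl
    ...   | inj₁ (w , pw≡pa , v∼w , b∼w) = inj₂ (twoStep Sb b∼w (inS pw≡pa Sa) (adj-sym G v∼w) Sv)
    ...   | inj₂ (inj₁ v∼a)              = inj₁ (step (here Sa) (adj-sym G v∼a) Sv)
    ...   | inj₂ (inj₂ b∼a)              = ⊥-elim (a≁b (adj-sym G b∼a))
    nonAdjacentPair {a} {b} Sa Sb pa≢pb a≁b v Sv | no pv≢pb with cover {a} {v} {b} pa≢pb pv≢pb refl
    ...   | inj₁ (w , pw≡pb , a∼w , v∼w) = inj₁ (twoStep Sa a∼w (inS pw≡pb Sb) (adj-sym G v∼w) Sv)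
    ...   | inj₂ (inj₁ a∼b)              = ⊥-elim (a≁b a∼b)
    ...   | inj₂ (inj₂ v∼b)              = inj₂ (step (here Sb) (adj-sym G v∼b) Sv)

    twoComponentsFrom : ∀ {a j} → S a → 𝒯 j → part a ≢ j
                      → Dec (∃ λ b → part b ≡ j × adj G a b ≢ true)
                      → AtMostTwoComponents G S
    twoComponentsFrom {a} Sa 𝒯j pa≢j (yes (b , pb≡j , a≁b)) =
      a , b , Sa , Sb , nonAdjacentPair Sa Sb (λ pa≡pb → pa≢j (trans pa≡pb pb≡j)) a≁b
      where
      Sb : S b
      Sb = inS pb≡j 𝒯j
    twoComponentsFrom {a} {j} Sa 𝒯j pa≢j (no allAdjacent) =
      a , a , Sa , Sa , λ v Sv → inj₁ (dominatingVertex Sa 𝒯j a∼Tj v Sv)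
      where
      a∼Tj : ∀ v → part v ≡ j → adj G a v ≡ true
      a∼Tj v pv≡j = decidable-stable (adj G a v Bool.≟ true) λ a≁v → allAdjacent (v , pv≡j , a≁v)

mainTheorem6 : ∀ {n k} (G : Graph n) (part : Fin n → Fin k)
    → (∀ i → 1 ≤ size part i)
    → PairwiseHalfDense G part
    → (𝒯 : Fin k → Set)
    → (∃ λ i → ∃ λ j → i ≢ j × 𝒯 i × 𝒯 j)
    → AtMostTwoComponents G (InUnion part 𝒯)
mainTheorem6 G part nonempty dense 𝒯 (i , j , i≢j , 𝒯i , 𝒯j) =
  twoComponentsFrom 𝒯 (inS 𝒯 pa≡i 𝒯i) 𝒯j (λ pa≡j → i≢j (trans (sym pa≡i) pa≡j)) nonNeighbour?
  where
  open HalfDense G part nonempty dense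
  a = proj₁ (vertexIn i)
  pa≡i = proj₂ (vertexIn i)
  nonNeighbour? = any? λ b → (part b ≟ j) ×-dec ¬? (adj G a b Bool.≟ true)
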